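{- Let $G=(V,E)$ be a finite graph and $v\in V$. Then $$\gamma_{coe}(G)-\deg(v)-1\leq \gamma_{coe}(G-v)\leq \gamma_{coe}(G)+\deg(v)-1,$$ where $\deg(v)$ is the degree of $v$ in $G$.
   Context: All graphs are finite, without loops and without directed edges. For a graph $H=(V,E)$, a set $D\subseteq V$ is a dominating set if every vertex in $V\setminus D$ is adjacent to at least one vertex of $D$. A dominating set $D$ is a co-even dominating set if every vertex $u\in V\setminus D$ has even degree in $H$. The co-even domination number $\gamma_{coe}(H)$ is the minimum cardinality of a co-even dominating set of $H$. The graph $G-v$ is obtained from $G$ by deleting the vertex $v$ and all edges incident to $v$. -}

module Defs where

open import Data.Nat using (ℕ; suc; _≤_)
open import Data.Nat.Divisibility using (_∣_)
open import Data.Bool using (Bool; true; false)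
open import Data.Fin using (Fin; punchIn)
open import Data.Fin.Subset using (Subset; _∈_; _∉_; ∣_∣)
open import Data.Vec using (tabulate)
open import Data.Product using (Σ; _×_; ∃)
open import Relation.Binary.PropositionalEquality using (_≡_)

record Graph (n : ℕ) : Set where
  field
    adj   : Fin n → Fin n → Bool
    sym   : ∀ u w → adj u w ≡ adj w u
    loopless : ∀ u → adj u u ≡ false
open Graph public

nbhd : ∀ {n} → Graph n → Fin n → Subset n
nbhd G u = tabulate (adj G u)

deg : ∀ {n} → Graph n → Fin n → ℕ
deg G u = ∣ nbhd G u ∣

delete : ∀ {n} → Graph (suc n) → Fin (suc n) → Graph n
delete G v = record
  { adj = λ i j → adj G (punchIn v i) (punchIn v j)
  ; sym = λ i j → sym G (punchIn v i) (punchIn v j)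
  ; loopless = λ i → loopless G (punchIn v i)
  }

IsDominating : ∀ {n} → Graph n → Subset n → Set
IsDominating {n} G D = ∀ u → u ∉ D → ∃ λ (w : Fin n) → w ∈ D × adj G u w ≡ true

IsCoEvenDominating : ∀ {n} → Graph n → Subset n → Set
IsCoEvenDominating G D = IsDominating G D × (∀ u → u ∉ D → 2 ∣ deg G u)

IsCoEvenDominationNumber : ∀ {n} → Graph n → ℕ → Set
IsCoEvenDominationNumber {n} G k =
  (Σ (Subset n) λ D → IsCoEvenDominating G D × ∣ D ∣ ≡ k)
  × (∀ D → IsCoEvenDominating G D → k ≤ ∣ D ∣)

module Submission where

-- Write N(v) for the neighbourhood of v. A co-even dominating set D of G yields
-- one of G - v by adding N(v) and then deleting v: the vertices left outside
-- are non-neighbours of v, so their dominator in D is not v and their degree is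
-- unchanged. Conversely, adding v and N(v) to a co-even dominating set of G - v
-- gives one of G. Counting, the first construction costs at most deg v - 1 extra
-- vertices, because either v ∈ D is deleted or v ∉ D has a dominator in D ∩ N(v);
-- the second costs at most deg v + 1.

open import Defs hiding (sym)
open import Data.Nat using (ℕ; suc; _+_; _≤_; _<_; z≤n; s≤s)
open import Data.Nat.Properties
  using (+-suc; +-comm; m≤m+n; m<m+n; ≤-<-trans; ≤-trans; ≤-reflexive; module ≤-Reasoning)
open import Data.Nat.Divisibility using (_∣_)
open import Data.Bool using (true)
open import Data.Fin using (Fin; zero; suc; punchIn; punchOut; _≟_)
open import Data.Fin.Properties using (punchInᵢ≢i; punchOut-punchIn; punchIn-punchOut)
open import Data.Fin.Subset using (Subset; inside; outside; _∈_; _∉_; _⊆_; _∪_; _∩_; ∣_∣)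
open import Data.Fin.Subset.Properties using (_∈?_; p⊆p∪q; q⊆p∪q; x∈p∪q⁻; x∈p∩q⁺; x∈p⇒∣p-x∣<∣p∣)
open import Data.Vec using (Vec; []; _∷_; lookup; tabulate; insertAt; removeAt)
open import Data.Vec.Properties
  using ( removeAt-punchOut; insertAt-removeAt; insertAt-lookup; insertAt-punchIn
        ; tabulate∘lookup; tabulate-cong; lookup∘tabulate; []=⇒lookup; lookup⇒[]=)
open import Data.Product using (∃; _×_; _,_)
open import Data.Sum using ([_,_]′)
open import Function using (_∘_)
open import Relation.Nullary using (yes; no; contradiction)
open import Relation.Binary.PropositionalEquality
  using (_≡_; _≢_; refl; sym; trans; cong; subst; module ≡-Reasoning)

private
  variable
    A : Set
    n : ℕ

lookup-removeAt : ∀ (xs : Vec A (suc n)) i j → lookup (removeAt xs i) j ≡ lookup xs (punchIn i j)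
lookup-removeAt xs i j = begin
  lookup (removeAt xs i) j                                ≡⟨ cong (lookup (removeAt xs i)) (sym (punchOut-punchIn i)) ⟩
  lookup (removeAt xs i) (punchOut (punchInᵢ≢i i j ∘ sym)) ≡⟨ removeAt-punchOut xs _ ⟩
  lookup xs (punchIn i j)                                 ∎
  where open ≡-Reasoning

removeAt-tabulate : ∀ (f : Fin (suc n) → A) i → removeAt (tabulate f) i ≡ tabulate (f ∘ punchIn i)
removeAt-tabulate f i = begin
  removeAt (tabulate f) i                    ≡⟨ sym (tabulate∘lookup _) ⟩
  tabulate (lookup (removeAt (tabulate f) i)) ≡⟨ tabulate-cong (λ j → trans (lookup-removeAt (tabulate f) i j) (lookup∘tabulate f _)) ⟩
  tabulate (f ∘ punchIn i)                   ∎
  where open ≡-Reasoning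

punchIn-onto : ∀ {i j : Fin (suc n)} → i ≢ j → ∃ λ k → punchIn i k ≡ j
punchIn-onto i≢j = punchOut i≢j , punchIn-punchOut i≢j

∉⇒lookup≡outside : ∀ {p : Subset n} {x} → x ∉ p → lookup p x ≡ outside
∉⇒lookup≡outside {p = p} {x} x∉p with lookup p x in eq
... | inside  = contradiction (lookup⇒[]= x p eq) x∉p
... | outside = refl

∈-removeAt⁺ : ∀ {p : Subset (suc n)} {x i} → punchIn x i ∈ p → i ∈ removeAt p x
∈-removeAt⁺ {p = p} {x} {i} m = lookup⇒[]= i _ (trans (lookup-removeAt p x i) ([]=⇒lookup m))

∈-removeAt⁻ : ∀ {p : Subset (suc n)} {x i} → i ∈ removeAt p x → punchIn x i ∈ p
∈-removeAt⁻ {p = p} {x} {i} m = lookup⇒[]= _ p (trans (sym (lookup-removeAt p x i)) ([]=⇒lookup m))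

∈-insertAt⁺ : ∀ {p : Subset n} {x i} s → i ∈ p → punchIn x i ∈ insertAt p x s
∈-insertAt⁺ {p = p} {x} {i} s m = lookup⇒[]= _ _ (trans (insertAt-punchIn p x s i) ([]=⇒lookup m))

∣insertAt∣≡∣∷∣ : ∀ (p : Subset n) x s → ∣ insertAt p x s ∣ ≡ ∣ s ∷ p ∣
∣insertAt∣≡∣∷∣ p             zero    s       = refl
∣insertAt∣≡∣∷∣ (inside  ∷ p) (suc x) inside  = cong suc (∣insertAt∣≡∣∷∣ p x inside)
∣insertAt∣≡∣∷∣ (inside  ∷ p) (suc x) outside = cong suc (∣insertAt∣≡∣∷∣ p x outside)
∣insertAt∣≡∣∷∣ (outside ∷ p) (suc x) s       = ∣insertAt∣≡∣∷∣ p x s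

∣p∣≡∣lookup∷removeAt∣ : ∀ (p : Subset (suc n)) x → ∣ p ∣ ≡ ∣ lookup p x ∷ removeAt p x ∣
∣p∣≡∣lookup∷removeAt∣ p x = trans (cong ∣_∣ (sym (insertAt-removeAt p x))) (∣insertAt∣≡∣∷∣ _ x _)

x∈p⇒∣p∣≡suc∣removeAt∣ : ∀ {p : Subset (suc n)} {x} → x ∈ p → ∣ p ∣ ≡ suc ∣ removeAt p x ∣
x∈p⇒∣p∣≡suc∣removeAt∣ {p = p} {x} x∈p =
  trans (∣p∣≡∣lookup∷removeAt∣ p x) (cong (λ s → ∣ s ∷ removeAt p x ∣) ([]=⇒lookup x∈p))

x∉p⇒∣p∣≡∣removeAt∣ : ∀ {p : Subset (suc n)} {x} → x ∉ p → ∣ p ∣ ≡ ∣ removeAt p x ∣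
x∉p⇒∣p∣≡∣removeAt∣ {p = p} {x} x∉p =
  trans (∣p∣≡∣lookup∷removeAt∣ p x) (cong (λ s → ∣ s ∷ removeAt p x ∣) (∉⇒lookup≡outside x∉p))

∣p∪q∣+∣p∩q∣≡∣p∣+∣q∣ : ∀ (p q : Subset n) → ∣ p ∪ q ∣ + ∣ p ∩ q ∣ ≡ ∣ p ∣ + ∣ q ∣
∣p∪q∣+∣p∩q∣≡∣p∣+∣q∣ []            []            = refl
∣p∪q∣+∣p∩q∣≡∣p∣+∣q∣ (inside  ∷ p) (inside  ∷ q) = begin
  suc (∣ p ∪ q ∣ + suc ∣ p ∩ q ∣) ≡⟨ cong suc (+-suc _ _) ⟩
  suc (suc (∣ p ∪ q ∣ + ∣ p ∩ q ∣)) ≡⟨ cong (λ k → suc (suc k)) (∣p∪q∣+∣p∩q∣≡∣p∣+∣q∣ p q) ⟩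
  suc (suc (∣ p ∣ + ∣ q ∣))         ≡⟨ cong suc (sym (+-suc _ _)) ⟩
  suc (∣ p ∣ + suc ∣ q ∣)           ∎
  where open ≡-Reasoning
∣p∪q∣+∣p∩q∣≡∣p∣+∣q∣ (inside  ∷ p) (outside ∷ q) = cong suc (∣p∪q∣+∣p∩q∣≡∣p∣+∣q∣ p q)
∣p∪q∣+∣p∩q∣≡∣p∣+∣q∣ (outside ∷ p) (inside  ∷ q) = trans (cong suc (∣p∪q∣+∣p∩q∣≡∣p∣+∣q∣ p q)) (sym (+-suc _ _))
∣p∪q∣+∣p∩q∣≡∣p∣+∣q∣ (outside ∷ p) (outside ∷ q) = ∣p∪q∣+∣p∩q∣≡∣p∣+∣q∣ p q

∣p∪q∣≤∣p∣+∣q∣ : ∀ (p q : Subset n) → ∣ p ∪ q ∣ ≤ ∣ p ∣ + ∣ q ∣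
∣p∪q∣≤∣p∣+∣q∣ p q = ≤-trans (m≤m+n _ _) (≤-reflexive (∣p∪q∣+∣p∩q∣≡∣p∣+∣q∣ p q))

x∈p∩q⇒∣p∪q∣<∣p∣+∣q∣ : ∀ {p q : Subset n} {x} → x ∈ p → x ∈ q → ∣ p ∪ q ∣ < ∣ p ∣ + ∣ q ∣
x∈p∩q⇒∣p∪q∣<∣p∣+∣q∣ {p = p} {q} x∈p x∈q = begin-strict
  ∣ p ∪ q ∣               <⟨ m<m+n _ (≤-<-trans z≤n (x∈p⇒∣p-x∣<∣p∣ (x∈p∩q⁺ (x∈p , x∈q)))) ⟩
  ∣ p ∪ q ∣ + ∣ p ∩ q ∣   ≡⟨ ∣p∪q∣+∣p∩q∣≡∣p∣+∣q∣ p q ⟩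
  ∣ p ∣ + ∣ q ∣           ∎
  where open ≤-Reasoning

module _ (G : Graph n) where

  lookup-nbhd : ∀ u w → lookup (nbhd G u) w ≡ adj G u w
  lookup-nbhd u = lookup∘tabulate (adj G u)

  adj⇒∈nbhd : ∀ {u w} → adj G u w ≡ true → w ∈ nbhd G u
  adj⇒∈nbhd {u} {w} uw = lookup⇒[]= w _ (trans (lookup-nbhd u w) uw)

  ∈nbhd⇒adj : ∀ {u w} → w ∈ nbhd G u → adj G u w ≡ true
  ∈nbhd⇒adj {u} {w} w∈ = trans (sym (lookup-nbhd u w)) ([]=⇒lookup w∈)

  ∈nbhd-sym : ∀ {u w} → w ∈ nbhd G u → u ∈ nbhd G w
  ∈nbhd-sym {u} {w} w∈ = adj⇒∈nbhd (trans (Graph.sym G w u) (∈nbhd⇒adj w∈))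

  ∉nbhd-self : ∀ u → u ∉ nbhd G u
  ∉nbhd-self u u∈ with trans (sym (loopless G u)) (∈nbhd⇒adj u∈)
  ... | ()

  IsCoEvenDominating-⊆ : ∀ {D S} → D ⊆ S → IsCoEvenDominating G D → IsCoEvenDominating G S
  IsCoEvenDominating-⊆ D⊆S (dom , even) =
    (λ u u∉S → let w , w∈D , uw = dom u (u∉S ∘ D⊆S) in w , D⊆S w∈D , uw) ,
    (λ u u∉S → even u (u∉S ∘ D⊆S))

module _ (G : Graph (suc n)) (v : Fin (suc n)) where

  deg-delete : ∀ i → v ∉ nbhd G (punchIn v i) → deg (delete G v) i ≡ deg G (punchIn v i)
  deg-delete i v∉N = begin
    deg (delete G v) i                   ≡⟨ cong ∣_∣ (sym (removeAt-tabulate (adj G (punchIn v i)) v)) ⟩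
    ∣ removeAt (nbhd G (punchIn v i)) v ∣ ≡⟨ sym (x∉p⇒∣p∣≡∣removeAt∣ v∉N) ⟩
    deg G (punchIn v i)                  ∎
    where open ≡-Reasoning

  v∉nbhd-outside : ∀ {S u} → nbhd G v ⊆ S → u ∉ S → v ∉ nbhd G u
  v∉nbhd-outside N⊆S u∉S = u∉S ∘ N⊆S ∘ ∈nbhd-sym G

  IsCoEvenDominating-delete⁺ : ∀ {S} → nbhd G v ⊆ S →
    IsCoEvenDominating G S → IsCoEvenDominating (delete G v) (removeAt S v)
  IsCoEvenDominating-delete⁺ {S} N⊆S (dom , even) = dom′ , even′
    where
    dom′ : IsDominating (delete G v) (removeAt S v)
    dom′ i i∉ with dom (punchIn v i) (i∉ ∘ ∈-removeAt⁺)
    ... | w , w∈S , uw with v ≟ w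
    ...   | yes refl = contradiction (adj⇒∈nbhd G uw) (v∉nbhd-outside N⊆S (i∉ ∘ ∈-removeAt⁺))
    ...   | no v≢w with punchIn-onto v≢w
    ...     | k , refl = k , ∈-removeAt⁺ w∈S , uw

    even′ : ∀ i → i ∉ removeAt S v → 2 ∣ deg (delete G v) i
    even′ i i∉ = subst (2 ∣_) (sym (deg-delete i (v∉nbhd-outside N⊆S u∉S))) (even (punchIn v i) u∉S)
      where u∉S = i∉ ∘ ∈-removeAt⁺

  IsCoEvenDominating-delete⁻ : ∀ {S} → v ∈ S → nbhd G v ⊆ S →
    IsCoEvenDominating (delete G v) (removeAt S v) → IsCoEvenDominating G S
  IsCoEvenDominating-delete⁻ {S} v∈S N⊆S (dom′ , even′) = dom , even
    where
    outside-punchIn : ∀ {u} → u ∉ S → ∃ λ i → punchIn v i ≡ u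
    outside-punchIn u∉S = punchIn-onto λ { refl → u∉S v∈S }

    dom : IsDominating G S
    dom u u∉S with outside-punchIn u∉S
    ... | i , refl with dom′ i (u∉S ∘ ∈-removeAt⁻)
    ...   | j , j∈ , ij = punchIn v j , ∈-removeAt⁻ j∈ , ij

    even : ∀ u → u ∉ S → 2 ∣ deg G u
    even u u∉S with outside-punchIn u∉S
    ... | i , refl = subst (2 ∣_) (deg-delete i (v∉nbhd-outside N⊆S u∉S)) (even′ i (u∉S ∘ ∈-removeAt⁻))

  cardinality-delete⁺ : ∀ {D} → IsCoEvenDominating G D →
    ∃ λ D′ → IsCoEvenDominating (delete G v) D′ × suc ∣ D′ ∣ ≤ ∣ D ∣ + deg G v
  cardinality-delete⁺ {D} D-coe@(dom , _) =
    removeAt S v ,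
    IsCoEvenDominating-delete⁺ (q⊆p∪q D N) (IsCoEvenDominating-⊆ G (p⊆p∪q N) D-coe) ,
    size
    where
    N = nbhd G v
    S = D ∪ N
    open ≤-Reasoning

    size : suc ∣ removeAt S v ∣ ≤ ∣ D ∣ + ∣ N ∣
    size with v ∈? D
    ... | yes v∈D = begin
      suc ∣ removeAt S v ∣ ≡⟨ sym (x∈p⇒∣p∣≡suc∣removeAt∣ (p⊆p∪q N v∈D)) ⟩
      ∣ S ∣                ≤⟨ ∣p∪q∣≤∣p∣+∣q∣ D N ⟩
      ∣ D ∣ + ∣ N ∣        ∎
    ... | no v∉D with dom v v∉D
    ...   | w , w∈D , vw = begin-strict
      ∣ removeAt S v ∣ ≡⟨ sym (x∉p⇒∣p∣≡∣removeAt∣ ([ v∉D , ∉nbhd-self G v ]′ ∘ x∈p∪q⁻ D N)) ⟩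
      ∣ S ∣            <⟨ x∈p∩q⇒∣p∪q∣<∣p∣+∣q∣ w∈D (adj⇒∈nbhd G vw) ⟩
      ∣ D ∣ + ∣ N ∣    ∎

  cardinality-delete⁻ : ∀ {D′} → IsCoEvenDominating (delete G v) D′ →
    ∃ λ D → IsCoEvenDominating G D × ∣ D ∣ ≤ ∣ D′ ∣ + deg G v + 1
  cardinality-delete⁻ {D′} D′-coe =
    S ,
    IsCoEvenDominating-delete⁻ (p⊆p∪q N v∈I) (q⊆p∪q I N) (IsCoEvenDominating-⊆ (delete G v) D′⊆ D′-coe) ,
    size
    where
    N = nbhd G v
    I = insertAt D′ v inside
    S = I ∪ N

    v∈I : v ∈ I
    v∈I = lookup⇒[]= v I (insertAt-lookup D′ v inside)

    D′⊆ : D′ ⊆ removeAt S v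
    D′⊆ i∈D′ = ∈-removeAt⁺ (p⊆p∪q N (∈-insertAt⁺ {x = v} inside i∈D′))

    size : ∣ S ∣ ≤ ∣ D′ ∣ + ∣ N ∣ + 1
    size = begin
      ∣ S ∣                 ≤⟨ ∣p∪q∣≤∣p∣+∣q∣ I N ⟩
      ∣ I ∣ + ∣ N ∣         ≡⟨ cong (_+ ∣ N ∣) (∣insertAt∣≡∣∷∣ D′ v inside) ⟩
      suc (∣ D′ ∣ + ∣ N ∣)  ≡⟨ +-comm 1 _ ⟩
      ∣ D′ ∣ + ∣ N ∣ + 1    ∎
      where open ≤-Reasoning

theorem2p3 : ∀ {n} (G : Graph (suc n)) (v : Fin (suc n)) (γG γGv : ℕ)
    → IsCoEvenDominationNumber G γG
    → IsCoEvenDominationNumber (delete G v) γGv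
    → (γG ≤ γGv + deg G v + 1) × (γGv + 1 ≤ γG + deg G v)
theorem2p3 G v _ γGv ((D , D-coe , refl) , γG-min) ((D′ , D′-coe , refl) , γGv-min) =
  let E , E-coe , ∣E∣≤ = cardinality-delete⁻ G v D′-coe
      R , R-coe , ∣R∣< = cardinality-delete⁺ G v D-coe
  in ≤-trans (γG-min E E-coe) ∣E∣≤ ,
     ≤-trans (≤-reflexive (+-comm γGv 1)) (≤-trans (s≤s (γGv-min R R-coe)) ∣R∣<)
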